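{- Let $n,m$ be integers with $1\le m\le n-1$, and let $S=\{n-m\}$. Then \[\#\widehat{P}(S,n)=\sum_{i=0}^{m-1}2^{i}\binom{n-(m-i)}{i+1}.\]
   Context: $S_n$ is the set of permutations $\pi=\pi_1\cdots\pi_n$ of $\{1,\dots,n\}$. Set $\pi_0=0$. An index $i\in\{1,\dots,n-1\}$ is a peak of $\pi$ if $\pi_{i-1}<\pi_i>\pi_{i+1}$. $\widehat{P}(S,n)$ is the set of $\pi\in S_n$ whose peak set (in this sense) equals $S$. -}

module Defs where

open import Data.Nat using (ℕ; zero; suc; _+_; _*_; _∸_; _^_; _<ᵇ_; _≡ᵇ_)
open import Data.Nat.ListAction using (sum)
open import Data.Nat.Combinatorics using (_C_)
open import Data.Bool using (Bool; true; false; _∧_; not; if_then_else_)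
open import Data.Fin using (Fin; toℕ)
open import Data.Vec using (Vec; []; _∷_)
open import Data.List using (List; []; _∷_; map; upTo; all)
open import Data.Product using (Σ)
open import Relation.Binary.PropositionalEquality using (_≡_)

-- A permutation π = π₁ ⋯ πₙ of {1,…,n} in one-line notation is represented by
-- a vector of length n over Fin n (value k : Fin n stands for k+1) whose entries
-- are pairwise distinct (hence a bijection, by pigeonhole).
-- All predicates are Bool-valued so that the subtype below is a set whose
-- elements are determined by the vector (no function-extensionality issues).

distinct : ∀ {k n} → Vec (Fin n) k → Bool
distinct [] = true
distinct (x ∷ xs) = notIn x xs ∧ distinct xs
  where
  notIn : ∀ {j} → Fin _ → Vec (Fin _) j → Bool
  notIn y [] = true
  notIn y (z ∷ zs) = not (toℕ y ≡ᵇ toℕ z) ∧ notIn y zs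

IsPerm : ∀ {n} → Vec (Fin n) n → Bool
IsPerm = distinct

word : ∀ {k n} → Vec (Fin n) k → List ℕ
word [] = []
word (x ∷ xs) = suc (toℕ x) ∷ word xs

withZero : ∀ {n} → Vec (Fin n) n → List ℕ
withZero π = 0 ∷ word π

-- Peak set of a word a₀ a₁ ⋯ aₙ, starting index p for a₀ offset:
-- given a list starting at index i-1, records the indices i with a_{i-1} < a_i > a_{i+1}
-- (these are exactly the i ∈ {1,…,n-1}, since a_{i+1} must exist and i ≥ 1).
peaksFrom : ℕ → List ℕ → List ℕ
peaksFrom i (a ∷ b ∷ c ∷ rest) =
  if (a <ᵇ b) ∧ (c <ᵇ b) then i ∷ peaksFrom (suc i) (b ∷ c ∷ rest)
  else peaksFrom (suc i) (b ∷ c ∷ rest)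
peaksFrom i _ = []

peakSet : ∀ {n} → Vec (Fin n) n → List ℕ
peakSet π = peaksFrom 1 (withZero π)

PHatSingleton : (n s : ℕ) → Set
PHatSingleton n s = Σ (Vec (Fin n) n) λ π → (IsPerm π ≡ true) × (peakSet π ≡ (s ∷ []))
  where open import Data.Product using (_×_)

rhs : ℕ → ℕ → ℕ
rhs n m = sum (map (λ i → 2 ^ i * ((n ∸ (m ∸ i)) C (suc i))) (upTo m))

-- Deleting the maximum n+1 from π ∈ S_{n+1} leaves σ ∈ S_n together with the position of n+1, and
-- this is a bijection. The inserted maximum is a peak unless it comes last, and it destroys the peaks
-- of its neighbours. So π has peak set {s+1} iff either n+1 comes last and σ has peak set {s+1}, or
-- n+1 sits at index s+1, σ₁ < ⋯ < σ_s, and σ_{s+1} ⋯ σ_n has no peak. If g(n, a) counts the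
-- σ ∈ S_n that are increasing up to a and peak-free afterwards, the same insertion argument gives
-- g(n+1, a) = g(n, a-1) + [a ≤ n] g(n, a) + [a < n] g(n, a), hence g(n, a) = 2^k C(n, k+1) for
-- a + k + 1 = n by Pascal's rule, and summing over n gives the formula.
module Submission where

open import Defs
open import Data.Nat as ℕ using (ℕ; zero; suc; _+_; _*_; _∸_; _^_; _≤_; _<_; z≤n; s≤s; _<ᵇ_)
import Data.Nat.Properties as ℕ
open import Data.Fin as Fin using (Fin; toℕ; fromℕ; fromℕ<; inject₁; lower₁; punchIn; punchOut)
import Data.Fin.Properties as Fin
open import Data.Vec as Vec using (Vec; []; _∷_; lookup; insertAt; tabulate)
import Data.Vec.Properties as Vec
open import Data.List as List using (List; []; _∷_; _++_; _∷ʳ_; length; take; drop; upTo)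
import Data.List.Properties as List
open import Data.List.Relation.Unary.All using (All; []; _∷_) renaming (map to All-map)
import Data.List.Relation.Unary.All.Properties as All
open import Data.Bool using (Bool; true; false; _∧_; not; if_then_else_; T)
import Data.Bool.Properties as Bool
open import Data.Product using (Σ; ∃; _×_; _,_; proj₁; proj₂)
open import Data.Product.Algebra using (Σ-assoc-alt)
open import Data.Product.Function.Dependent.Propositional using (Σ-↔)
open import Data.Sum using (_⊎_; inj₁; inj₂)
open import Data.Sum.Function.Propositional using (_⊎-↔_)
open import Data.Empty using (⊥)
open import Data.Unit using (tt)
open import Function using (_∘_)
open import Function.Bundles using (_↔_; _⇔_; mk↔ₛ′; mk⇔; Equivalence)
open import Function.Definitions using (Injective)
open import Function.Properties.Inverse using (↔-trans; ↔-sym; ↔-refl)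
open import Function.Properties.Equivalence using () renaming (refl to ⇔-refl; sym to ⇔-sym)
open import Function.Related.Propositional using (module EquationalReasoning)
open import Data.Product.Function.NonDependent.Propositional using (_×-⇔_)
open import Function.Related.TypeIsomorphisms using (Σ-distribˡ-⊎)
open import Relation.Nullary using (¬_; yes; no; Dec; does; Irrelevant; contradiction)
open import Relation.Nullary.Decidable using (dec-true; dec-false)
open import Relation.Binary.PropositionalEquality
open import Data.Nat.Combinatorics using (_C_; nC1≡n; k>n⇒nCk≡0; nCk+nC[k+1]≡[n+1]C[k+1])
open import Data.Nat.ListAction using (sum)
open import Data.Nat.ListAction.Properties using (sum-++)
open import Data.Nat.Solver using (module +-*-Solver)
import Axiom.UniquenessOfIdentityProofs as UIP

×-irrelevant : {P Q : Set} → Irrelevant P → Irrelevant Q → Irrelevant (P × Q)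
×-irrelevant P-irr Q-irr (p , q) (p′ , q′) = cong₂ _,_ (P-irr p p′) (Q-irr q q′)

⊎-irrelevant : {P Q : Set} → Irrelevant P → Irrelevant Q → (P → ¬ Q) → Irrelevant (P ⊎ Q)
⊎-irrelevant P-irr Q-irr P⇒¬Q (inj₁ p) (inj₁ p′) = cong inj₁ (P-irr p p′)
⊎-irrelevant P-irr Q-irr P⇒¬Q (inj₁ p) (inj₂ q)  = contradiction q (P⇒¬Q p)
⊎-irrelevant P-irr Q-irr P⇒¬Q (inj₂ q) (inj₁ p)  = contradiction q (P⇒¬Q p)
⊎-irrelevant P-irr Q-irr P⇒¬Q (inj₂ q) (inj₂ q′) = cong inj₂ (Q-irr q q′)

list-≡-irrelevant : {xs ys : List ℕ} → Irrelevant (xs ≡ ys)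
list-≡-irrelevant = UIP.Decidable⇒UIP.≡-irrelevant (List.≡-dec ℕ._≟_)

bool-≡-irrelevant : {b c : Bool} → Irrelevant (b ≡ c)
bool-≡-irrelevant = UIP.Decidable⇒UIP.≡-irrelevant Bool._≟_

Σ-≡-irrelevant : {A : Set} {P : A → Set} → (∀ a → Irrelevant (P a)) →
                 {a a′ : A} {p : P a} {p′ : P a′} → a ≡ a′ → (a , p) ≡ (a′ , p′)
Σ-≡-irrelevant P-irr {p = p} {p′} refl = cong (_ ,_) (P-irr _ p p′)

Irrelevant-⇔⇒↔ : {P Q : Set} → Irrelevant P → Irrelevant Q → P ⇔ Q → P ↔ Q
Irrelevant-⇔⇒↔ P-irr Q-irr P⇔Q =
  mk↔ₛ′ (Equivalence.to P⇔Q) (Equivalence.from P⇔Q) (λ q → Q-irr _ q) (λ p → P-irr _ p)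

¬⇒↔Fin0 : {A : Set} → ¬ A → A ↔ Fin 0
¬⇒↔Fin0 ¬a = mk↔ₛ′ (λ a → contradiction a ¬a) (λ ()) (λ ()) (λ a → contradiction a ¬a)

⊎↔Fin+ : {A B : Set} {k l : ℕ} → A ↔ Fin k → B ↔ Fin l → (A ⊎ B) ↔ Fin (k + l)
⊎↔Fin+ A↔k B↔l = ↔-trans (A↔k ⊎-↔ B↔l) (↔-sym Fin.+↔⊎)

Dec↔Fin : {P A : Set} {k : ℕ} (P? : Dec P) → (P → A ↔ Fin k) → (¬ P → ¬ A) →
          A ↔ Fin (if does P? then k else 0)
Dec↔Fin (yes p) A↔k ¬A = A↔k p
Dec↔Fin (no ¬p) A↔k ¬A = ¬⇒↔Fin0 (¬A ¬p)

Σ-pinPosition : {m : ℕ} {X : Set} {Q : X → Set} (k : ℕ) → k < m → (∀ x → Irrelevant (Q x)) →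
                Σ (Fin m × X) (λ (p , x) → toℕ p ≡ k × Q x) ↔ Σ X Q
Σ-pinPosition k k<m Q-irr =
  mk↔ₛ′ (λ ((_ , x) , _ , q) → x , q)
        (λ (x , q) → (fromℕ< k<m , x) , Fin.toℕ-fromℕ< k<m , q)
        (λ _ → refl)
        (λ { ((p , x) , refl , q) →
               Σ-≡-irrelevant (λ (_ , x) → ×-irrelevant ℕ.≡-irrelevant (Q-irr x))
                 (cong (_, x) (Fin.toℕ-injective (Fin.toℕ-fromℕ< k<m))) })

T-not : ∀ b → T (not b) ⇔ (¬ T b)
T-not true  = mk⇔ (λ ()) (λ ¬t → ¬t tt)
T-not false = mk⇔ (λ _ ()) (λ _ → tt)

T-not-≡ᵇ⇔≢ : ∀ {n} (x y : Fin n) → T (not (toℕ x ℕ.≡ᵇ toℕ y)) ⇔ (y ≢ x)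
T-not-≡ᵇ⇔≢ x y = mk⇔
  (λ t y≡x → Equivalence.to (T-not _) t (ℕ.≡⇒≡ᵇ _ _ (cong toℕ (sym y≡x))))
  (λ y≢x → Equivalence.from (T-not _) (λ t → y≢x (sym (Fin.toℕ-injective (ℕ.≡ᵇ⇒≡ _ _ t)))))

distinct-∷ : ∀ {k n} (x : Fin n) (xs : Vec (Fin n) k) →
             T (distinct (x ∷ xs)) ⇔ ((∀ j → lookup xs j ≢ x) × T (distinct xs))
distinct-∷ x [] = mk⇔ (λ _ → (λ ()) , tt) (λ _ → tt)
distinct-∷ x (y ∷ ys) = mk⇔ forth back
  where
  open Equivalence
  forth : T (distinct (x ∷ y ∷ ys)) → (∀ j → lookup (y ∷ ys) j ≢ x) × T (distinct (y ∷ ys))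
  forth t =
    let x≢y∧x∉ys , y∷ys-distinct = to Bool.T-∧ t
        x≢y , x∉ys = to Bool.T-∧ x≢y∧x∉ys
        _ , ys-distinct = to Bool.T-∧ y∷ys-distinct
        ys≢x , _ = to (distinct-∷ x ys) (from Bool.T-∧ (x∉ys , ys-distinct))
    in (λ { Fin.zero → to (T-not-≡ᵇ⇔≢ x y) x≢y ; (Fin.suc j) → ys≢x j }) , y∷ys-distinct
  back : (∀ j → lookup (y ∷ ys) j ≢ x) × T (distinct (y ∷ ys)) → T (distinct (x ∷ y ∷ ys))
  back (y∷ys≢x , y∷ys-distinct) =
    let _ , ys-distinct = to Bool.T-∧ y∷ys-distinct
        x∉ys , _ = to Bool.T-∧ (from (distinct-∷ x ys) (y∷ys≢x ∘ Fin.suc , ys-distinct))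
    in from Bool.T-∧ (from Bool.T-∧ (from (T-not-≡ᵇ⇔≢ x y) (y∷ys≢x Fin.zero) , x∉ys) , y∷ys-distinct)

distinct⇔injective : ∀ {k n} (v : Vec (Fin n) k) → T (distinct v) ⇔ Injective _≡_ _≡_ (lookup v)
distinct⇔injective [] = mk⇔ (λ { _ {()} }) (λ _ → tt)
distinct⇔injective (x ∷ xs) = mk⇔ forth back
  where
  open Equivalence
  forth : T (distinct (x ∷ xs)) → Injective _≡_ _≡_ (lookup (x ∷ xs))
  forth t {i} {j} with xs≢x , xs-distinct ← to (distinct-∷ x xs) t | i | j
  ... | Fin.zero  | Fin.zero  = λ _ → refl
  ... | Fin.zero  | Fin.suc j = λ x≡xsj → contradiction (sym x≡xsj) (xs≢x j)
  ... | Fin.suc i | Fin.zero  = λ xsi≡x → contradiction xsi≡x (xs≢x i)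
  ... | Fin.suc i | Fin.suc j = cong Fin.suc ∘ to (distinct⇔injective xs) xs-distinct
  back : Injective _≡_ _≡_ (lookup (x ∷ xs)) → T (distinct (x ∷ xs))
  back inj = from (distinct-∷ x xs)
    ( (λ j xsj≡x → Fin.0≢1+n (inj (sym xsj≡x)))
    , from (distinct⇔injective xs) (Fin.suc-injective ∘ inj) )

-- Inserting the maximum

Perm : ℕ → Set
Perm n = Σ (Vec (Fin n) n) (λ π → IsPerm π ≡ true)

IsPerm⇔injective : ∀ {n} (π : Vec (Fin n) n) → (IsPerm π ≡ true) ⇔ Injective _≡_ _≡_ (lookup π)
IsPerm⇔injective π = mk⇔ (Equivalence.to (distinct⇔injective π) ∘ Equivalence.from Bool.T-≡)
                         (Equivalence.to Bool.T-≡ ∘ Equivalence.from (distinct⇔injective π))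

≡⊎≡punchIn : ∀ {n} (p i : Fin (suc n)) → i ≡ p ⊎ ∃ λ j → i ≡ punchIn p j
≡⊎≡punchIn p i with i Fin.≟ p
... | yes i≡p = inj₁ i≡p
... | no i≢p  = inj₂ (punchOut (i≢p ∘ sym) , sym (Fin.punchIn-punchOut (i≢p ∘ sym)))

insertMax : ∀ {n} → Fin (suc n) → Vec (Fin n) n → Vec (Fin (suc n)) (suc n)
insertMax {n} p σ = insertAt (Vec.map inject₁ σ) p (fromℕ n)

lookup-insertMax : ∀ {n} (p : Fin (suc n)) (σ : Vec (Fin n) n) → lookup (insertMax p σ) p ≡ fromℕ n
lookup-insertMax p σ = Vec.insertAt-lookup _ p _

lookup-insertMax-punchIn : ∀ {n} (p : Fin (suc n)) (σ : Vec (Fin n) n) j →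
                           lookup (insertMax p σ) (punchIn p j) ≡ inject₁ (lookup σ j)
lookup-insertMax-punchIn p σ j = trans (Vec.insertAt-punchIn _ p _ j) (Vec.lookup-map j inject₁ σ)

insertMax-max≢punchIn : ∀ {n} (p : Fin (suc n)) (σ : Vec (Fin n) n) j →
                        lookup (insertMax p σ) p ≢ lookup (insertMax p σ) (punchIn p j)
insertMax-max≢punchIn p σ j eq = Fin.fromℕ≢inject₁
  (trans (sym (lookup-insertMax p σ)) (trans eq (lookup-insertMax-punchIn p σ j)))

insertMax-injective : ∀ {n} (p : Fin (suc n)) (σ : Vec (Fin n) n) →
                      Injective _≡_ _≡_ (lookup σ) → Injective _≡_ _≡_ (lookup (insertMax p σ))
insertMax-injective p σ σ-inj {i} {j} eq with ≡⊎≡punchIn p i | ≡⊎≡punchIn p j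
... | inj₁ refl | inj₁ refl = refl
... | inj₁ refl | inj₂ (j′ , refl) = contradiction eq (insertMax-max≢punchIn p σ j′)
... | inj₂ (i′ , refl) | inj₁ refl = contradiction (sym eq) (insertMax-max≢punchIn p σ i′)
... | inj₂ (i′ , refl) | inj₂ (j′ , refl) =
  cong (punchIn p) (σ-inj (Fin.inject₁-injective (trans (sym (lookup-insertMax-punchIn p σ i′))
                                              (trans eq (lookup-insertMax-punchIn p σ j′)))))

maxPosition : ∀ {n} (π : Vec (Fin (suc n)) (suc n)) → Injective _≡_ _≡_ (lookup π) →
              ∃ λ p → lookup π p ≡ fromℕ n
maxPosition {n} π π-inj with Fin.any? (λ i → lookup π i Fin.≟ fromℕ n)
... | yes found = found
... | no ¬found =
  let i , j , i<j , fi≡fj = Fin.pigeonhole (ℕ.n<1+n n) below-max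
  in contradiction (cong toℕ (π-inj (Fin.lower₁-injective fi≡fj))) (ℕ.<⇒≢ i<j)
  where
  below-max : Fin (suc n) → Fin n
  below-max i = lower₁ (lookup π i)
    (λ n≡πi → ¬found (i , Fin.toℕ-injective (trans (sym n≡πi) (sym (Fin.toℕ-fromℕ n)))))

lookup-extensionality : ∀ {A : Set} {k} {xs ys : Vec A k} → (∀ i → lookup xs i ≡ lookup ys i) → xs ≡ ys
lookup-extensionality {xs = xs} {ys} eq =
  trans (sym (Vec.tabulate∘lookup xs)) (trans (Vec.tabulate-cong eq) (Vec.tabulate∘lookup ys))

module _ {n} (π : Vec (Fin (suc n)) (suc n)) (π-inj : Injective _≡_ _≡_ (lookup π))
         (p : Fin (suc n)) (π[p]≡max : lookup π p ≡ fromℕ n) where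

  deleteMax : Vec (Fin n) n
  deleteMax = tabulate λ j → lower₁ (lookup π (punchIn p j)) (max≢ j)
    where
    max≢ : ∀ j → n ≢ toℕ (lookup π (punchIn p j))
    max≢ j n≡ = Fin.punchInᵢ≢i p j (π-inj (Fin.toℕ-injective
      (trans (sym n≡) (trans (sym (Fin.toℕ-fromℕ n)) (cong toℕ (sym π[p]≡max))))))

  inject₁-lookup-deleteMax : ∀ j → inject₁ (lookup deleteMax j) ≡ lookup π (punchIn p j)
  inject₁-lookup-deleteMax j = trans (cong inject₁ (Vec.lookup∘tabulate _ j)) (Fin.inject₁-lower₁ _ _)

  deleteMax-injective : Injective _≡_ _≡_ (lookup deleteMax)
  deleteMax-injective {i} {j} eq = Fin.punchIn-injective p i j (π-inj
    (trans (sym (inject₁-lookup-deleteMax i)) (trans (cong inject₁ eq) (inject₁-lookup-deleteMax j))))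

  insertMax-deleteMax : insertMax p deleteMax ≡ π
  insertMax-deleteMax = lookup-extensionality λ i → at i (≡⊎≡punchIn p i)
    where
    at : ∀ i → i ≡ p ⊎ ∃ (λ j → i ≡ punchIn p j) → lookup (insertMax p deleteMax) i ≡ lookup π i
    at i (inj₁ refl)       = trans (lookup-insertMax p _) (sym π[p]≡max)
    at i (inj₂ (j , refl)) = trans (lookup-insertMax-punchIn p _ j) (inject₁-lookup-deleteMax j)

deleteMax-insertMax : ∀ {n} (p : Fin (suc n)) (σ : Vec (Fin n) n) (π-inj : Injective _≡_ _≡_ (lookup (insertMax p σ)))
                      q (π[q]≡max : lookup (insertMax p σ) q ≡ fromℕ n) → q ≡ p →
                      deleteMax (insertMax p σ) π-inj q π[q]≡max ≡ σ
deleteMax-insertMax p σ π-inj q π[q]≡max refl = lookup-extensionality λ j → Fin.inject₁-injective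
  (trans (inject₁-lookup-deleteMax (insertMax p σ) π-inj p π[q]≡max j) (lookup-insertMax-punchIn p σ j))

Perm-suc↔ : ∀ {n} → Perm (suc n) ↔ (Fin (suc n) × Perm n)
Perm-suc↔ {n} = mk↔ₛ′ remove insert remove∘insert insert∘remove
  where
  open Equivalence
  perm-irrelevant : ∀ {k} (π : Vec (Fin k) k) → Irrelevant (IsPerm π ≡ true)
  perm-irrelevant _ = bool-≡-irrelevant
  injective : ∀ {k} (π : Perm k) → Injective _≡_ _≡_ (lookup (proj₁ π))
  injective (π , π-perm) = to (IsPerm⇔injective π) π-perm
  remove : Perm (suc n) → Fin (suc n) × Perm n
  remove x@(π , _) with p , π[p]≡max ← maxPosition π (injective x) =
    p , deleteMax π (injective x) p π[p]≡max
      , from (IsPerm⇔injective (deleteMax π (injective x) p π[p]≡max)) (deleteMax-injective π (injective x) p π[p]≡max)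
  insert : Fin (suc n) × Perm n → Perm (suc n)
  insert (p , σ) =
    insertMax p (proj₁ σ)
    , from (IsPerm⇔injective (insertMax p (proj₁ σ))) (insertMax-injective p (proj₁ σ) (injective σ))
  remove∘insert : ∀ y → remove (insert y) ≡ y
  remove∘insert y@(p , σ , _) with q , π[q]≡max ← maxPosition (insertMax p σ) (injective (insert y)) =
    cong₂ _,_ q≡p (Σ-≡-irrelevant perm-irrelevant (deleteMax-insertMax p σ (injective (insert y)) q π[q]≡max q≡p))
    where
    q≡p : q ≡ p
    q≡p = injective (insert y) (trans π[q]≡max (sym (lookup-insertMax p σ)))
  insert∘remove : ∀ x → insert (remove x) ≡ x
  insert∘remove x@(π , _) with p , π[p]≡max ← maxPosition π (injective x) =
    Σ-≡-irrelevant perm-irrelevant (insertMax-deleteMax π (injective x) p π[p]≡max)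

-- Peaks around the maximum of a word

PeakFree : List ℕ → Set
PeakFree w = peaksFrom 0 w ≡ []

-- For the word of a permutation prefix u this says that u is increasing.
PeakFree₀ : List ℕ → Set
PeakFree₀ u = peaksFrom 1 (0 ∷ u) ≡ []

if-∷-≡[] : ∀ c {x y : ℕ} {X Y : List ℕ} → (X ≡ [] → Y ≡ []) →
           (if c then x ∷ X else X) ≡ [] → (if c then y ∷ Y else Y) ≡ []
if-∷-≡[] false X≡[]⇒Y≡[] = X≡[]⇒Y≡[]
if-∷-≡[] true  _ ()

peaksFrom-≡[] : ∀ i j w → peaksFrom i w ≡ [] → peaksFrom j w ≡ []
peaksFrom-≡[] i j []                _ = refl
peaksFrom-≡[] i j (_ ∷ [])          _ = refl
peaksFrom-≡[] i j (_ ∷ _ ∷ [])      _ = refl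
peaksFrom-≡[] i j (a ∷ b ∷ c ∷ w) =
  if-∷-≡[] ((a <ᵇ b) ∧ (c <ᵇ b)) (peaksFrom-≡[] (suc i) (suc j) (b ∷ c ∷ w))

<ᵇ-true : ∀ {m n} → m < n → (m <ᵇ n) ≡ true
<ᵇ-true m<n = Equivalence.to Bool.T-≡ (ℕ.<⇒<ᵇ m<n)

<ᵇ-false : ∀ {m n} → n < m → (m <ᵇ n) ≡ false
<ᵇ-false {m} {n} n<m = Equivalence.to Bool.T-not-≡
  (Equivalence.from (T-not (m <ᵇ n)) (λ t → ℕ.<-asym n<m (ℕ.<ᵇ⇒< m n t)))

peaksFrom-max∷ : ∀ i {M} w → All (_< M) w → peaksFrom i (M ∷ w) ≡ peaksFrom (suc i) w
peaksFrom-max∷ i []          _              = refl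
peaksFrom-max∷ i (_ ∷ [])    _              = refl
peaksFrom-max∷ i (b ∷ _ ∷ _) (b<M ∷ _) rewrite <ᵇ-false b<M = refl

-- The maximum, at index k, is a peak iff something follows it.
peaksAfterMax : ℕ → List ℕ → List ℕ
peaksAfterMax k []      = []
peaksAfterMax k (y ∷ v) = k ∷ peaksFrom (2 + k) (y ∷ v)

if-∷-++ : ∀ c (x : ℕ) (X Y : List ℕ) → (if c then x ∷ X else X) ++ Y ≡ (if c then x ∷ (X ++ Y) else X ++ Y)
if-∷-++ false _ _ _ = refl
if-∷-++ true  _ _ _ = refl

peaksFrom-insertMax : ∀ i {M} x u v → All (_< M) (x ∷ u) → All (_< M) v →
  peaksFrom i (x ∷ u ++ M ∷ v) ≡ peaksFrom i (x ∷ u) ++ peaksAfterMax (i + length u) v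
peaksFrom-insertMax i x [] [] _ _ = refl
peaksFrom-insertMax i x [] (y ∷ v) (x<M ∷ []) y∷v<M@(y<M ∷ _)
  rewrite <ᵇ-true x<M | <ᵇ-true y<M | ℕ.+-identityʳ i = cong (i ∷_) (peaksFrom-max∷ (suc i) (y ∷ v) y∷v<M)
peaksFrom-insertMax i {M} x (y ∷ []) v (_ ∷ y<M ∷ []) v<M = begin
  (if (x <ᵇ y) ∧ (M <ᵇ y) then i ∷ peaksFrom (suc i) (y ∷ M ∷ v) else peaksFrom (suc i) (y ∷ M ∷ v))
    ≡⟨ cong (λ c → if c then _ else _) (trans (cong ((x <ᵇ y) ∧_) (<ᵇ-false y<M)) (Bool.∧-zeroʳ (x <ᵇ y))) ⟩
  peaksFrom (suc i) (y ∷ M ∷ v)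
    ≡⟨ peaksFrom-insertMax (suc i) y [] v (y<M ∷ []) v<M ⟩
  peaksAfterMax (suc i + 0) v
    ≡⟨ cong (λ k → peaksAfterMax k v) (trans (ℕ.+-identityʳ (suc i)) (ℕ.+-comm 1 i)) ⟩
  peaksAfterMax (i + 1) v  ∎
  where open ≡-Reasoning
peaksFrom-insertMax i {M} x (y ∷ z ∷ u) v (_ ∷ y∷z∷u<M) v<M = begin
  (if c then i ∷ peaksFrom (suc i) (y ∷ z ∷ u ++ M ∷ v) else peaksFrom (suc i) (y ∷ z ∷ u ++ M ∷ v))
    ≡⟨ cong (λ R → if c then i ∷ R else R) (peaksFrom-insertMax (suc i) y (z ∷ u) v y∷z∷u<M v<M) ⟩
  (if c then i ∷ (P ++ peaksAfterMax (suc i + length (z ∷ u)) v) else P ++ peaksAfterMax (suc i + length (z ∷ u)) v)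
    ≡⟨ sym (if-∷-++ c i P _) ⟩
  (if c then i ∷ P else P) ++ peaksAfterMax (suc i + length (z ∷ u)) v
    ≡⟨ cong (λ k → (if c then i ∷ P else P) ++ peaksAfterMax k v) (sym (ℕ.+-suc i (length (z ∷ u)))) ⟩
  (if c then i ∷ P else P) ++ peaksAfterMax (i + length (y ∷ z ∷ u)) v  ∎
  where
  open ≡-Reasoning
  c = (x <ᵇ y) ∧ (z <ᵇ y)
  P = peaksFrom (suc i) (y ∷ z ∷ u)

peaksFrom-insertMax-≡[] : ∀ i {M} x u v → All (_< M) (x ∷ u) → All (_< M) v →
  peaksFrom i (x ∷ u ++ M ∷ v) ≡ [] ⇔ (peaksFrom i (x ∷ u) ≡ [] × v ≡ [])
peaksFrom-insertMax-≡[] i x u [] x∷u<M [] = mk⇔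
  (λ eq → trans (sym (List.++-identityʳ _)) (trans (sym (peaksFrom-insertMax i x u [] x∷u<M [])) eq) , refl)
  (λ (eq , _) → trans (peaksFrom-insertMax i x u [] x∷u<M []) (trans (List.++-identityʳ _) eq))
peaksFrom-insertMax-≡[] i x u (y ∷ v) x∷u<M y∷v<M = mk⇔
  (λ eq → contradiction (List.++-conicalʳ (peaksFrom i (x ∷ u)) _
            (trans (sym (peaksFrom-insertMax i x u (y ∷ v) x∷u<M y∷v<M)) eq)) λ ())
  (λ { (_ , ()) })

PeakFree-max∷ : ∀ {M} v → All (_< M) v → PeakFree (M ∷ v) ⇔ PeakFree v
PeakFree-max∷ v v<M = mk⇔
  (λ eq → peaksFrom-≡[] 1 0 v (trans (sym (peaksFrom-max∷ 0 v v<M)) eq))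
  (λ eq → trans (peaksFrom-max∷ 0 v v<M) (peaksFrom-≡[] 0 1 v eq))

PeakFree₀-insertMax : ∀ {m} u v → All (_< suc m) u → All (_< suc m) v →
                      PeakFree₀ (u ++ suc m ∷ v) ⇔ (PeakFree₀ u × v ≡ [])
PeakFree₀-insertMax u v u<M v<M = peaksFrom-insertMax-≡[] 1 0 u v (ℕ.z<s ∷ u<M) v<M

take-++-length : ∀ (u z : List ℕ) d → take (length u + d) (u ++ z) ≡ u ++ take d z
take-++-length []      z d = refl
take-++-length (x ∷ u) z d = cong (x ∷_) (take-++-length u z d)

drop-++-length : ∀ (u z : List ℕ) d → drop (length u + d) (u ++ z) ≡ drop d z
drop-++-length []      z d = refl
drop-++-length (x ∷ u) z d = drop-++-length u z d

SplitPeakFree : ℕ → List ℕ → Set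
SplitPeakFree a w = PeakFree₀ (take a w) × PeakFree (drop a w)

SplitPeakFree-++ : ∀ u v → SplitPeakFree (length u) (u ++ v) ⇔ (PeakFree₀ u × PeakFree v)
SplitPeakFree-++ u v = mk⇔
  (λ (l , r) → subst PeakFree₀ take≡ l , subst PeakFree drop≡ r)
  (λ (l , r) → subst PeakFree₀ (sym take≡) l , subst PeakFree (sym drop≡) r)
  where
  take≡ : take (length u) (u ++ v) ≡ u
  take≡ = trans (cong (λ k → take k (u ++ v)) (sym (ℕ.+-identityʳ (length u))))
                (trans (take-++-length u v 0) (List.++-identityʳ u))
  drop≡ : drop (length u) (u ++ v) ≡ v
  drop≡ = trans (cong (λ k → drop k (u ++ v)) (sym (ℕ.+-identityʳ (length u)))) (drop-++-length u v 0)

-- The positions t at which the maximum can be inserted into a word w of length n so that the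
-- split after a stays peak-free: last entry of the prefix, first entry of the suffix, or very end.
EndOfPrefix : ℕ → ℕ → List ℕ → Set
EndOfPrefix zero    t w = ⊥
EndOfPrefix (suc a) t w = t ≡ a × SplitPeakFree a w

InsertSplit : ℕ → ℕ → ℕ → List ℕ → Set
InsertSplit a t n w = EndOfPrefix a t w ⊎ (t ≡ a × SplitPeakFree a w) ⊎ (t ≡ n × a < n × SplitPeakFree a w)

InsertSplit-≡ : ∀ {a t n w} → t ≡ a → InsertSplit a t n w ⇔ SplitPeakFree a w
InsertSplit-≡ {suc a} refl = mk⇔ (λ { (inj₁ (t≡a , _)) → contradiction t≡a ℕ.1+n≢n
                                     ; (inj₂ (inj₁ (_ , spf))) → spf
                                     ; (inj₂ (inj₂ (refl , a<a , _))) → contradiction a<a (ℕ.n≮n _) })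
                                 (λ spf → inj₂ (inj₁ (refl , spf)))
InsertSplit-≡ {zero} refl = mk⇔ (λ { (inj₂ (inj₁ (_ , spf))) → spf
                                   ; (inj₂ (inj₂ (refl , () , _))) })
                                (λ spf → inj₂ (inj₁ (refl , spf)))

InsertSplit-> : ∀ {a t n w} → a < t → InsertSplit a t n w ⇔ (t ≡ n × SplitPeakFree a w)
InsertSplit-> {suc a} a<t = mk⇔
  (λ { (inj₁ (refl , _)) → contradiction a<t (ℕ.<-asym (ℕ.n<1+n a))
     ; (inj₂ (inj₁ (refl , _))) → contradiction a<t (ℕ.n≮n _)
     ; (inj₂ (inj₂ (t≡n , _ , spf))) → t≡n , spf })
  (λ (t≡n , spf) → inj₂ (inj₂ (t≡n , subst (_ <_) t≡n a<t , spf)))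
InsertSplit-> {zero} a<t = mk⇔
  (λ { (inj₂ (inj₁ (refl , _))) → contradiction a<t (ℕ.n≮n _)
     ; (inj₂ (inj₂ (t≡n , _ , spf))) → t≡n , spf })
  (λ (t≡n , spf) → inj₂ (inj₂ (t≡n , subst (_ <_) t≡n a<t , spf)))

InsertSplit-< : ∀ {a t n w} → t < a → InsertSplit a t n w ⇔ (suc t ≡ a × SplitPeakFree t w)
InsertSplit-< {suc a} t<a = mk⇔
  (λ { (inj₁ (refl , spf)) → refl , spf
     ; (inj₂ (inj₁ (refl , _))) → contradiction t<a (ℕ.n≮n _)
     ; (inj₂ (inj₂ (refl , a<t , _))) → contradiction t<a (ℕ.<-asym a<t) })
  (λ { (refl , spf) → inj₁ (refl , spf) })

data Cut : ℕ → List ℕ → Set where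
  at     : ∀ u → Cut (length u) u
  before : ∀ u₁ x z → Cut (length u₁) (u₁ ++ x ∷ z)
  beyond : ∀ u d → Cut (length u + suc d) u

cut : ∀ a u → Cut a u
cut zero    []      = at []
cut zero    (x ∷ z) = before [] x z
cut (suc a) []      = beyond [] a
cut (suc a) (y ∷ u) with cut a u
... | at .u           = at (y ∷ u)
... | before u₁ x z   = before (y ∷ u₁) x z
... | beyond .u d     = beyond (y ∷ u) d

length≡⇔≡[] : ∀ {n} (u v : List ℕ) → length u + length v ≡ n → length u ≡ n ⇔ v ≡ []
length≡⇔≡[] u []      len≡ = mk⇔ (λ _ → refl) (λ _ → trans (sym (ℕ.+-identityʳ (length u))) len≡)
length≡⇔≡[] u (_ ∷ _) refl = mk⇔ (λ u≡n → contradiction (sym u≡n) (ℕ.m+1+n≢m (length u))) (λ ())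

take-≡[]⇒≡0 : ∀ d (v : List ℕ) → d ≤ length v → take d v ≡ [] → d ≡ 0
take-≡[]⇒≡0 zero    v       _ _ = refl
take-≡[]⇒≡0 (suc d) (_ ∷ _) _ ()

module _ {m n : ℕ} (v : List ℕ) (v<M : All (_< suc m) v) where
  open EquationalReasoning
  private M = suc m

  splitPeakFree-insertMax-at : ∀ u → SplitPeakFree (length u) (u ++ M ∷ v) ⇔ InsertSplit (length u) (length u) n (u ++ v)
  splitPeakFree-insertMax-at u = begin
    SplitPeakFree (length u) (u ++ M ∷ v)  ∼⟨ SplitPeakFree-++ u (M ∷ v) ⟩
    (PeakFree₀ u × PeakFree (M ∷ v))       ∼⟨ ⇔-refl ×-⇔ PeakFree-max∷ v v<M ⟩
    (PeakFree₀ u × PeakFree v)             ∼⟨ ⇔-sym (SplitPeakFree-++ u v) ⟩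
    SplitPeakFree (length u) (u ++ v)      ∼⟨ ⇔-sym (InsertSplit-≡ refl) ⟩
    InsertSplit (length u) (length u) n (u ++ v)  ∎

  splitPeakFree-insertMax-before : ∀ u₁ x z → let u = u₁ ++ x ∷ z in
    length u + length v ≡ n → All (_< M) u →
    SplitPeakFree (length u₁) (u ++ M ∷ v) ⇔ InsertSplit (length u₁) (length u) n (u ++ v)
  splitPeakFree-insertMax-before u₁ x z len≡ u<M = begin
    SplitPeakFree (length u₁) ((u₁ ++ x ∷ z) ++ M ∷ v)
      ≡⟨ cong (SplitPeakFree (length u₁)) (List.++-assoc u₁ (x ∷ z) (M ∷ v)) ⟩
    SplitPeakFree (length u₁) (u₁ ++ x ∷ z ++ M ∷ v)
      ∼⟨ SplitPeakFree-++ u₁ (x ∷ z ++ M ∷ v) ⟩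
    (PeakFree₀ u₁ × PeakFree (x ∷ z ++ M ∷ v))
      ∼⟨ ⇔-refl ×-⇔ peaksFrom-insertMax-≡[] 0 x z v (All.++⁻ʳ u₁ u<M) v<M ⟩
    (PeakFree₀ u₁ × PeakFree (x ∷ z) × v ≡ [])
      ∼⟨ mk⇔ (λ { (p , q , refl) → refl , p , subst PeakFree (sym (List.++-identityʳ (x ∷ z))) q })
             (λ { (refl , p , q) → p , subst PeakFree (List.++-identityʳ (x ∷ z)) q , refl }) ⟩
    (v ≡ [] × PeakFree₀ u₁ × PeakFree (x ∷ z ++ v))
      ∼⟨ ⇔-sym (length≡⇔≡[] (u₁ ++ x ∷ z) v len≡) ×-⇔ ⇔-sym (SplitPeakFree-++ u₁ (x ∷ z ++ v)) ⟩
    (length (u₁ ++ x ∷ z) ≡ n × SplitPeakFree (length u₁) (u₁ ++ x ∷ z ++ v))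
      ≡⟨ cong (λ w → _ × SplitPeakFree (length u₁) w) (sym (List.++-assoc u₁ (x ∷ z) v)) ⟩
    (length (u₁ ++ x ∷ z) ≡ n × SplitPeakFree (length u₁) ((u₁ ++ x ∷ z) ++ v))
      ∼⟨ ⇔-sym (InsertSplit-> u₁<u) ⟩
    InsertSplit (length u₁) (length (u₁ ++ x ∷ z)) n ((u₁ ++ x ∷ z) ++ v)  ∎
    where
    u₁<u : length u₁ < length (u₁ ++ x ∷ z)
    u₁<u = subst (length u₁ <_) (sym (List.length-++ u₁)) (ℕ.m<m+n (length u₁) ℕ.z<s)

  splitPeakFree-insertMax-beyond : ∀ u d → length u + length v ≡ n → All (_< M) u → length u + suc d ≤ suc n →
    SplitPeakFree (length u + suc d) (u ++ M ∷ v) ⇔ InsertSplit (length u + suc d) (length u) n (u ++ v)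
  splitPeakFree-insertMax-beyond u d len≡ u<M a≤1+n = begin
    SplitPeakFree (length u + suc d) (u ++ M ∷ v)
      ≡⟨ cong₂ (λ l r → PeakFree₀ l × PeakFree r)
               (take-++-length u (M ∷ v) (suc d)) (drop-++-length u (M ∷ v) (suc d)) ⟩
    (PeakFree₀ (u ++ M ∷ take d v) × PeakFree (drop d v))
      ∼⟨ PeakFree₀-insertMax u (take d v) u<M (All.take⁺ d v<M) ×-⇔ ⇔-refl ⟩
    ((PeakFree₀ u × take d v ≡ []) × PeakFree (drop d v))
      ∼⟨ mk⇔ (λ ((p , take≡[]) , q) → d≡0 take≡[] , p , subst (λ k → PeakFree (drop k v)) (d≡0 take≡[]) q)
             (λ { (refl , p , q) → (p , refl) , q }) ⟩
    (d ≡ 0 × PeakFree₀ u × PeakFree v)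
      ∼⟨ mk⇔ (λ { (refl , pq) → ℕ.+-comm 1 (length u) , pq })
             (λ (1+u≡ , pq) → sym (ℕ.suc-injective (ℕ.+-cancelˡ-≡ (length u) 1 (suc d)
                                   (trans (ℕ.+-comm (length u) 1) 1+u≡))) , pq) ⟩
    (suc (length u) ≡ length u + suc d × PeakFree₀ u × PeakFree v)
      ∼⟨ ⇔-refl ×-⇔ ⇔-sym (SplitPeakFree-++ u v) ⟩
    (suc (length u) ≡ length u + suc d × SplitPeakFree (length u) (u ++ v))
      ∼⟨ ⇔-sym (InsertSplit-< (ℕ.m<m+n (length u) ℕ.z<s)) ⟩
    InsertSplit (length u + suc d) (length u) n (u ++ v)  ∎
    where
    d≡0 : take d v ≡ [] → d ≡ 0
    d≡0 = take-≡[]⇒≡0 d v (ℕ.+-cancelˡ-≤ (suc (length u)) d (length v)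
            (subst (_≤ suc (length u + length v)) (ℕ.+-suc (length u) d)
                   (subst (λ k → length u + suc d ≤ suc k) (sym len≡) a≤1+n)))

splitPeakFree-insertMax : ∀ {m n} a u v → length u + length v ≡ n → All (_< suc m) u → All (_< suc m) v →
  a ≤ suc n → SplitPeakFree a (u ++ suc m ∷ v) ⇔ InsertSplit a (length u) n (u ++ v)
splitPeakFree-insertMax {m} {n} a u v len≡ u<M v<M = via (cut a u) len≡ u<M
  where
  via : ∀ {a u} → Cut a u → length u + length v ≡ n → All (_< suc m) u →
        a ≤ suc n → SplitPeakFree a (u ++ suc m ∷ v) ⇔ InsertSplit a (length u) n (u ++ v)
  via (at u)          _    _   _   = splitPeakFree-insertMax-at v v<M u
  via (before u₁ x z) len≡ u<M _   = splitPeakFree-insertMax-before v v<M u₁ x z len≡ u<M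
  via (beyond u d)    len≡ u<M a≤ = splitPeakFree-insertMax-beyond v v<M u d len≡ u<M a≤

++-∷-≡[-] : ∀ (X : List ℕ) {k j Y} → X ++ k ∷ Y ≡ j ∷ [] ⇔ (X ≡ [] × k ≡ j × Y ≡ [])
++-∷-≡[-] []      = mk⇔ (λ { refl → refl , refl , refl }) (λ { (refl , refl , refl) → refl })
++-∷-≡[-] (x ∷ X) = mk⇔ (λ eq → contradiction (List.++-conicalʳ X _ (proj₂ (List.∷-injective eq))) λ ())
                        (λ { (() , _) })

PeakSetIs : List ℕ → List ℕ → Set
PeakSetIs S w = peaksFrom 1 (0 ∷ w) ≡ S

-- The maximum, inserted at 0-based position t (so at index t + 1 after π₀ = 0), either comes last
-- or is itself the only peak.
InsertOnePeak : ℕ → ℕ → ℕ → List ℕ → Set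
InsertOnePeak s t n w = (t ≡ n × PeakSetIs (suc s ∷ []) w) ⊎ (t ≡ s × s < n × SplitPeakFree s w)

onePeak-insertMax : ∀ {m n} s u v → length u + length v ≡ n → All (_< suc m) u → All (_< suc m) v →
  PeakSetIs (suc s ∷ []) (u ++ suc m ∷ v) ⇔ InsertOnePeak s (length u) n (u ++ v)
onePeak-insertMax {m} s u [] len≡ u<M [] = mk⇔
  (λ eq → inj₁ (u≡n , subst (PeakSetIs _) (sym (List.++-identityʳ u))
                       (trans (sym (List.++-identityʳ _)) (trans (sym insert≡) eq))))
  (λ { (inj₁ (_ , eq)) → trans insert≡ (trans (List.++-identityʳ _) (subst (PeakSetIs _) (List.++-identityʳ u) eq))
     ; (inj₂ (refl , s<n , _)) → contradiction (subst (length u <_) (sym u≡n) s<n) (ℕ.n≮n _) })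
  where
  insert≡ = peaksFrom-insertMax 1 0 u [] (ℕ.z<s ∷ u<M) []
  u≡n = trans (sym (ℕ.+-identityʳ (length u))) len≡
onePeak-insertMax {m} {n} s u (y ∷ v) len≡ u<M y∷v<M = mk⇔ forth back
  where
  open Equivalence
  insert≡ = peaksFrom-insertMax 1 0 u (y ∷ v) (ℕ.z<s ∷ u<M) y∷v<M
  u<n : length u < n
  u<n = subst (length u <_) len≡ (ℕ.m<m+n (length u) ℕ.z<s)
  forth : PeakSetIs (suc s ∷ []) (u ++ suc m ∷ y ∷ v) → InsertOnePeak s (length u) n (u ++ y ∷ v)
  forth eq =
    let P≡[] , 1+u≡1+s , Q≡[] = to (++-∷-≡[-] (peaksFrom 1 (0 ∷ u))) (trans (sym insert≡) eq)
        u≡s = ℕ.suc-injective 1+u≡1+s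
    in inj₂ (u≡s , subst (_< n) u≡s u<n , subst (λ k → SplitPeakFree k (u ++ y ∷ v)) u≡s
               (from (SplitPeakFree-++ u (y ∷ v)) (P≡[] , peaksFrom-≡[] _ 0 (y ∷ v) Q≡[])))
  back : InsertOnePeak s (length u) n (u ++ y ∷ v) → PeakSetIs (suc s ∷ []) (u ++ suc m ∷ y ∷ v)
  back (inj₁ (u≡n , _)) = contradiction u≡n (ℕ.<⇒≢ u<n)
  back (inj₂ (u≡s , _ , spf)) =
    let P≡[] , Q≡[] = to (SplitPeakFree-++ u (y ∷ v)) (subst (λ k → SplitPeakFree k (u ++ y ∷ v)) (sym u≡s) spf)
    in trans insert≡ (from (++-∷-≡[-] (peaksFrom 1 (0 ∷ u)))
                           (P≡[] , cong suc u≡s , peaksFrom-≡[] 0 _ (y ∷ v) Q≡[]))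

length-word : ∀ {m k} (xs : Vec (Fin m) k) → length (word xs) ≡ k
length-word []       = refl
length-word (x ∷ xs) = cong suc (length-word xs)

word-< : ∀ {m k} (xs : Vec (Fin m) k) → All (_< suc m) (word xs)
word-< []       = []
word-< (x ∷ xs) = s≤s (Fin.toℕ<n x) ∷ word-< xs

word-map-inject₁ : ∀ {m k} (xs : Vec (Fin m) k) → word (Vec.map inject₁ xs) ≡ word xs
word-map-inject₁ []       = refl
word-map-inject₁ (x ∷ xs) = cong₂ _∷_ (cong suc (Fin.toℕ-inject₁ x)) (word-map-inject₁ xs)

word-insertMax : ∀ {m k} (p : Fin (suc k)) (xs : Vec (Fin m) k) →
  word (insertAt (Vec.map inject₁ xs) p (fromℕ m)) ≡ take (toℕ p) (word xs) ++ suc m ∷ drop (toℕ p) (word xs)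
word-insertMax {m} Fin.zero xs      = cong₂ _∷_ (cong suc (Fin.toℕ-fromℕ m)) (word-map-inject₁ xs)
word-insertMax (Fin.suc p) (x ∷ xs) = cong₂ _∷_ (cong suc (Fin.toℕ-inject₁ x)) (word-insertMax p xs)

module InsertionPoint {n} (p : Fin (suc n)) (σ : Vec (Fin n) n) where
  u v : List ℕ
  u = take (toℕ p) (word σ)
  v = drop (toℕ p) (word σ)

  u++v : u ++ v ≡ word σ
  u++v = List.take++drop≡id (toℕ p) (word σ)

  length-u : length u ≡ toℕ p
  length-u = trans (List.length-take (toℕ p) (word σ))
                   (ℕ.m≤n⇒m⊓n≡m (subst (toℕ p ≤_) (sym (length-word σ)) (ℕ.s≤s⁻¹ (Fin.toℕ<n p))))

  length-u+v : length u + length v ≡ n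
  length-u+v = trans (sym (List.length-++ u)) (trans (cong length u++v) (length-word σ))

  u<M : All (_< suc n) u
  u<M = All.take⁺ (toℕ p) (word-< σ)

  v<M : All (_< suc n) v
  v<M = All.drop⁺ (toℕ p) (word-< σ)

  open EquationalReasoning

  onePeak : ∀ s → PeakSetIs (suc s ∷ []) (word (insertMax p σ)) ⇔ InsertOnePeak s (toℕ p) n (word σ)
  onePeak s = begin
    PeakSetIs (suc s ∷ []) (word (insertMax p σ))  ≡⟨ cong (PeakSetIs _) (word-insertMax p σ) ⟩
    PeakSetIs (suc s ∷ []) (u ++ suc n ∷ v)       ∼⟨ onePeak-insertMax s u v length-u+v u<M v<M ⟩
    InsertOnePeak s (length u) n (u ++ v)          ≡⟨ cong₂ (λ t w → InsertOnePeak s t n w) length-u u++v ⟩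
    InsertOnePeak s (toℕ p) n (word σ)             ∎

  splitPeakFree : ∀ a → a ≤ suc n →
    SplitPeakFree a (word (insertMax p σ)) ⇔ InsertSplit a (toℕ p) n (word σ)
  splitPeakFree a a≤1+n = begin
    SplitPeakFree a (word (insertMax p σ))  ≡⟨ cong (SplitPeakFree a) (word-insertMax p σ) ⟩
    SplitPeakFree a (u ++ suc n ∷ v)       ∼⟨ splitPeakFree-insertMax a u v length-u+v u<M v<M a≤1+n ⟩
    InsertSplit a (length u) n (u ++ v)     ≡⟨ cong₂ (λ t w → InsertSplit a t n w) length-u u++v ⟩
    InsertSplit a (toℕ p) n (word σ)        ∎

-- Counting by insertion of the maximum

PermsWith : ℕ → (List ℕ → Set) → Set
PermsWith n P = Σ (Perm n) (λ π → P (word (proj₁ π)))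

PermsWith-suc↔ : ∀ {n} (P : List ℕ → Set) →
  Σ (Fin (suc n) × Perm n) (λ (p , σ) → P (word (insertMax p (proj₁ σ)))) ↔ PermsWith (suc n) P
PermsWith-suc↔ P = Σ-↔ (↔-sym Perm-suc↔) ↔-refl

Σ-⇔ : {X : Set} {P Q : X → Set} → (∀ x → Irrelevant (P x)) → (∀ x → Irrelevant (Q x)) →
      (∀ x → P x ⇔ Q x) → Σ X P ↔ Σ X Q
Σ-⇔ P-irr Q-irr P⇔Q = Σ-↔ ↔-refl (λ {x} → Irrelevant-⇔⇒↔ (P-irr x) (Q-irr x) (P⇔Q x))

Σ-pinPosition-if : {m k c : ℕ} {X C : Set} {Q : X → Set} (C? : Dec C) → Irrelevant C → (∀ x → Irrelevant (Q x)) →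
  (C → k < m) → (C → Σ X Q ↔ Fin c) →
  Σ (Fin m × X) (λ (p , x) → toℕ p ≡ k × C × Q x) ↔ Fin (if does C? then c else 0)
Σ-pinPosition-if {k = k} C? C-irr Q-irr k<m count = Dec↔Fin C?
  (λ c → ↔-trans (Σ-pinPosition k (k<m c) (λ x → ×-irrelevant C-irr (Q-irr x)))
         (↔-trans (Σ-⇔ (λ x → ×-irrelevant C-irr (Q-irr x)) Q-irr (λ _ → mk⇔ proj₂ (c ,_))) (count c)))
  (λ ¬c (_ , _ , c , _) → ¬c c)

SplitPeakFree-irrelevant : ∀ a w → Irrelevant (SplitPeakFree a w)
SplitPeakFree-irrelevant a w = ×-irrelevant list-≡-irrelevant list-≡-irrelevant

InsertSplit-irrelevant : ∀ a t n w → Irrelevant (InsertSplit a t n w)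
InsertSplit-irrelevant a t n w = ⊎-irrelevant (end-irrelevant a)
  (⊎-irrelevant (×-irrelevant ℕ.≡-irrelevant spf-irr)
                (×-irrelevant ℕ.≡-irrelevant (×-irrelevant ℕ.<-irrelevant spf-irr))
                (λ (t≡a , _) (t≡n , a<n , _) → ℕ.<⇒≢ a<n (trans (sym t≡a) t≡n)))
  (end-disjoint a)
  where
  spf-irr = SplitPeakFree-irrelevant a w
  end-irrelevant : ∀ a → Irrelevant (EndOfPrefix a t w)
  end-irrelevant (suc a) = ×-irrelevant ℕ.≡-irrelevant (SplitPeakFree-irrelevant a w)
  end-disjoint : ∀ a → EndOfPrefix a t w → ¬ ((t ≡ a × SplitPeakFree a w) ⊎ (t ≡ n × a < n × SplitPeakFree a w))
  end-disjoint (suc a) (refl , _) (inj₁ (t≡1+t , _))       = ℕ.1+n≢n (sym t≡1+t)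
  end-disjoint (suc a) (refl , _) (inj₂ (refl , 1+t<t , _)) = ℕ.<-asym (ℕ.n<1+n t) 1+t<t

InsertOnePeak-irrelevant : ∀ s t n w → Irrelevant (InsertOnePeak s t n w)
InsertOnePeak-irrelevant s t n w = ⊎-irrelevant
  (×-irrelevant ℕ.≡-irrelevant list-≡-irrelevant)
  (×-irrelevant ℕ.≡-irrelevant (×-irrelevant ℕ.<-irrelevant (SplitPeakFree-irrelevant s w)))
  (λ (t≡n , _) (t≡s , s<n , _) → ℕ.<⇒≢ s<n (trans (sym t≡s) t≡n))

atPred : (ℕ → ℕ) → ℕ → ℕ
atPred f zero    = 0
atPred f (suc a) = f a

splitCount : ℕ → ℕ → ℕ
splitCount zero    a = 1
splitCount (suc n) a = atPred (splitCount n) a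
                     + ((if does (a ℕ.≤? n) then splitCount n a else 0) + (if does (a ℕ.<? n) then splitCount n a else 0))

SplitPerms↔ : ∀ n a → a ≤ n → PermsWith n (SplitPeakFree a) ↔ Fin (splitCount n a)
SplitPerms↔ zero .zero z≤n = mk↔ₛ′ (λ _ → Fin.zero) (λ _ → ([] , refl) , refl , refl)
  (λ { Fin.zero → refl ; (Fin.suc ()) })
  (λ { (([] , refl) , spf) → cong (([] , refl) ,_) (SplitPeakFree-irrelevant 0 [] _ spf) })
SplitPerms↔ (suc n) a a≤1+n =
  ↔-trans (↔-sym (PermsWith-suc↔ (SplitPeakFree a)))
  (↔-trans (Σ-⇔ (λ _ → SplitPeakFree-irrelevant a _) (λ _ → InsertSplit-irrelevant a _ n _)
                (λ (p , σ) → InsertionPoint.splitPeakFree p (proj₁ σ) a a≤1+n))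
  (↔-trans Σ-distribˡ-⊎
  (⊎↔Fin+ (endOfPrefix a a≤1+n)
  (↔-trans Σ-distribˡ-⊎ (⊎↔Fin+ startOfSuffix atEnd)))))
  where
  Y = Fin (suc n) × Perm n
  endOfPrefix : ∀ a → a ≤ suc n →
                Σ Y (λ (p , σ) → EndOfPrefix a (toℕ p) (word (proj₁ σ))) ↔ Fin (atPred (splitCount n) a)
  endOfPrefix zero    _     = ¬⇒↔Fin0 λ ()
  endOfPrefix (suc a) a<1+n =
    ↔-trans (Σ-pinPosition a a<1+n (λ _ → SplitPeakFree-irrelevant a _)) (SplitPerms↔ n a (ℕ.s≤s⁻¹ a<1+n))
  startOfSuffix : Σ Y (λ (p , σ) → toℕ p ≡ a × SplitPeakFree a (word (proj₁ σ)))
                  ↔ Fin (if does (a ℕ.≤? n) then splitCount n a else 0)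
  startOfSuffix = Dec↔Fin (a ℕ.≤? n)
    (λ a≤n → ↔-trans (Σ-pinPosition a (s≤s a≤n) (λ _ → SplitPeakFree-irrelevant a _)) (SplitPerms↔ n a a≤n))
    (λ a≰n ((p , _) , p≡a , _) → a≰n (subst (_≤ n) p≡a (ℕ.s≤s⁻¹ (Fin.toℕ<n p))))
  atEnd : Σ Y (λ (p , σ) → toℕ p ≡ n × a < n × SplitPeakFree a (word (proj₁ σ)))
          ↔ Fin (if does (a ℕ.<? n) then splitCount n a else 0)
  atEnd = Σ-pinPosition-if (a ℕ.<? n) ℕ.<-irrelevant (λ _ → SplitPeakFree-irrelevant a _)
            (λ _ → ℕ.n<1+n n) (λ a<n → SplitPerms↔ n a (ℕ.<⇒≤ a<n))

onePeakCount : ℕ → ℕ → ℕ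
onePeakCount zero    s = 0
onePeakCount (suc n) s = onePeakCount n s + (if does (s ℕ.<? n) then splitCount n s else 0)

OnePeakPerms↔ : ∀ n s → PermsWith n (PeakSetIs (suc s ∷ [])) ↔ Fin (onePeakCount n s)
OnePeakPerms↔ zero    s = ¬⇒↔Fin0 λ { (([] , _) , ()) }
OnePeakPerms↔ (suc n) s =
  ↔-trans (↔-sym (PermsWith-suc↔ (PeakSetIs (suc s ∷ []))))
  (↔-trans (Σ-⇔ (λ _ → list-≡-irrelevant) (λ _ → InsertOnePeak-irrelevant s _ n _)
                (λ (p , σ) → InsertionPoint.onePeak p (proj₁ σ) s))
  (↔-trans Σ-distribˡ-⊎
  (⊎↔Fin+ (↔-trans (Σ-pinPosition n (ℕ.n<1+n n) (λ _ → list-≡-irrelevant)) (OnePeakPerms↔ n s))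
          (Σ-pinPosition-if (s ℕ.<? n) ℕ.<-irrelevant (λ _ → SplitPeakFree-irrelevant s _)
             ℕ.m<n⇒m<1+n (λ s<n → SplitPerms↔ n s (ℕ.<⇒≤ s<n))))))

-- Closed forms

if-true : ∀ {A : Set} {P : Set} (P? : Dec P) (x y : A) → P → (if does P? then x else y) ≡ x
if-true P? x y p rewrite dec-true P? p = refl

if-false : ∀ {A : Set} {P : Set} (P? : Dec P) (x y : A) → ¬ P → (if does P? then x else y) ≡ y
if-false P? x y ¬p rewrite dec-false P? ¬p = refl

splitCount-diag : ∀ n → splitCount n n ≡ 1
splitCount-diag zero    = refl
splitCount-diag (suc n) rewrite splitCount-diag n
                              | if-false (suc n ℕ.≤? n) (splitCount n (suc n)) 0 ℕ.1+n≰n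
                              | if-false (suc n ℕ.<? n) (splitCount n (suc n)) 0 (ℕ.<-asym (ℕ.n<1+n n)) = refl

splitCount-suc : ∀ a → splitCount (suc a) a ≡ suc a
splitCount-suc zero    = refl
splitCount-suc (suc a) rewrite splitCount-suc a
                             | if-true (suc a ℕ.≤? suc a) (splitCount (suc a) (suc a)) 0 ℕ.≤-refl
                             | if-false (suc a ℕ.<? suc a) (splitCount (suc a) (suc a)) 0 (ℕ.n≮n _)
                             | splitCount-diag (suc a) = ℕ.+-comm (suc a) 1

splitCount-closed : ∀ n a k → a + suc k ≡ n → splitCount n a ≡ 2 ^ k * (n C suc k)
splitCount-closed zero a k eq = contradiction (trans (sym (ℕ.+-suc a k)) eq) (λ ())
splitCount-closed (suc n) a zero eq with refl ← ℕ.suc-injective (trans (sym (ℕ.+-comm a 1)) eq) =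
  trans (splitCount-suc a) (sym (trans (ℕ.*-identityˡ _) (nC1≡n (suc a))))
splitCount-closed (suc n) a (suc k) eq = begin
  atPred (splitCount n) a + ((if does (a ℕ.≤? n) then splitCount n a else 0)
                           + (if does (a ℕ.<? n) then splitCount n a else 0))
    ≡⟨ cong₂ (λ x y → atPred (splitCount n) a + (x + y))
             (if-true (a ℕ.≤? n) _ 0 (ℕ.<⇒≤ a<n)) (if-true (a ℕ.<? n) _ 0 a<n) ⟩
  atPred (splitCount n) a + (splitCount n a + splitCount n a)
    ≡⟨ cong₂ (λ x y → x + (y + y)) (atPred-closed a a+k+1≡n) (splitCount-closed n a k a+k+1≡n) ⟩
  2 ^ suc k * (n C suc (suc k)) + (2 ^ k * (n C suc k) + 2 ^ k * (n C suc k))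
    ≡⟨ double-distrib (2 ^ k) (n C suc k) (n C suc (suc k)) ⟩
  2 ^ suc k * (n C suc k + n C suc (suc k))
    ≡⟨ cong (2 ^ suc k *_) (nCk+nC[k+1]≡[n+1]C[k+1] n (suc k)) ⟩
  2 ^ suc k * (suc n C suc (suc k))  ∎
  where
  open ≡-Reasoning
  a+k+1≡n : a + suc k ≡ n
  a+k+1≡n = ℕ.suc-injective (trans (sym (ℕ.+-suc a (suc k))) eq)
  a<n : a < n
  a<n = subst (a <_) a+k+1≡n (ℕ.m<m+n a ℕ.z<s)
  atPred-closed : ∀ a → a + suc k ≡ n → atPred (splitCount n) a ≡ 2 ^ suc k * (n C suc (suc k))
  atPred-closed zero    refl = sym (trans (cong (2 ^ suc k *_) (k>n⇒nCk≡0 (ℕ.n<1+n (suc k)))) (ℕ.*-zeroʳ (2 ^ suc k)))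
  atPred-closed (suc b) b+k+2≡n = splitCount-closed n b (suc k) (trans (ℕ.+-suc b (suc k)) b+k+2≡n)
  double-distrib : ∀ x y z → 2 * x * z + (x * y + x * y) ≡ 2 * x * (y + z)
  double-distrib = solve 3 (λ x y z → con 2 :* x :* z :+ (x :* y :+ x :* y) := con 2 :* x :* (y :+ z)) refl
    where open +-*-Solver

rhs-step : ∀ n k → rhs (suc n) (suc k) ≡ rhs n k + 2 ^ k * (n C suc k)
rhs-step n k = begin
  sum (List.map term′ (upTo (suc k)))
    ≡⟨ cong (sum ∘ List.map term′) (sym (List.upTo-∷ʳ k)) ⟩
  sum (List.map term′ (upTo k ∷ʳ k))
    ≡⟨ cong sum (List.map-++ term′ (upTo k) (k ∷ [])) ⟩
  sum (List.map term′ (upTo k) ++ term′ k ∷ [])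
    ≡⟨ sum-++ (List.map term′ (upTo k)) (term′ k ∷ []) ⟩
  sum (List.map term′ (upTo k)) + (term′ k + 0)
    ≡⟨ cong₂ _+_ (cong sum (List.map-cong-local (All-map term′≡term (All.all-upTo k))))
                 (trans (ℕ.+-identityʳ _) (cong (λ j → 2 ^ k * ((suc n ∸ j) C suc k)) (ℕ.m+n∸n≡m 1 k))) ⟩
  sum (List.map term (upTo k)) + 2 ^ k * (n C suc k)  ∎
  where
  open ≡-Reasoning
  term′ term : ℕ → ℕ
  term′ i = 2 ^ i * ((suc n ∸ (suc k ∸ i)) C suc i)
  term  i = 2 ^ i * ((n ∸ (k ∸ i)) C suc i)
  term′≡term : ∀ {i} → i < k → term′ i ≡ term i
  term′≡term {i} i<k = cong (λ j → 2 ^ i * ((suc n ∸ j) C suc i)) (ℕ.+-∸-assoc 1 (ℕ.<⇒≤ i<k))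

onePeakCount-≤ : ∀ n s → n ≤ suc s → onePeakCount n s ≡ 0
onePeakCount-≤ zero    s _       = refl
onePeakCount-≤ (suc n) s n<1+s   =
  cong₂ _+_ (onePeakCount-≤ n s (ℕ.<⇒≤ n<1+s))
            (if-false (s ℕ.<? n) (splitCount n s) 0 (ℕ.≤⇒≯ (ℕ.s≤s⁻¹ n<1+s)))

onePeakCount-closed : ∀ n s k → suc s + suc k ≡ n → onePeakCount n s ≡ rhs n (suc k)
onePeakCount-closed zero s k ()
onePeakCount-closed (suc n) s k eq = begin
  onePeakCount n s + (if does (s ℕ.<? n) then splitCount n s else 0)
    ≡⟨ cong₂ _+_ (earlier k s+k+1≡n) (trans (if-true (s ℕ.<? n) _ 0 s<n) (splitCount-closed n s k s+k+1≡n)) ⟩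
  rhs n k + 2 ^ k * (n C suc k)
    ≡⟨ sym (rhs-step n k) ⟩
  rhs (suc n) (suc k)  ∎
  where
  open ≡-Reasoning
  s+k+1≡n : s + suc k ≡ n
  s+k+1≡n = ℕ.suc-injective eq
  s<n : s < n
  s<n = subst (s <_) s+k+1≡n (ℕ.m<m+n s ℕ.z<s)
  earlier : ∀ k → s + suc k ≡ n → onePeakCount n s ≡ rhs n k
  earlier zero    refl = onePeakCount-≤ (s + 1) s (ℕ.≤-reflexive (ℕ.+-comm s 1))
  earlier (suc k) s+k+2≡n = onePeakCount-closed n s k (trans (sym (ℕ.+-suc s (suc k))) s+k+2≡n)

proposition4p8 : (n m : ℕ) → 1 ≤ m → m ≤ n ∸ 1 →
    PHatSingleton n (n ∸ m) ↔ Fin (rhs n m)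
proposition4p8 zero    (suc k) _ ()
proposition4p8 (suc n) (suc k) _ 1+k≤n =
  subst (λ S → PHatSingleton (suc n) S ↔ Fin (rhs (suc n) (suc k))) (sym (ℕ.+-∸-assoc 1 1+k≤n))
    (↔-trans (↔-sym Σ-assoc-alt)
    (subst (λ c → PermsWith (suc n) (PeakSetIs (suc s ∷ [])) ↔ Fin c)
           (onePeakCount-closed (suc n) s k (cong suc (ℕ.m∸n+n≡m 1+k≤n)))
           (OnePeakPerms↔ (suc n) s)))
  where s = n ∸ suc k
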